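{- Let $A$ be a coherent quantale and $a\in A$. If $A$ has the property (*), then the quantale $[a)_A$ has the property (*).
   Context: A quantale is a complete lattice $(A,\vee,\wedge,0,1)$ with an associative, commutative multiplication $\cdot$ with unit $1$ distributing over arbitrary joins. $K(Q)$ is the set of compact elements of $Q$; $A$ is coherent if every element is a join of compact elements, $1\in K(A)$ and $K(A)$ is closed under $\cdot$. $B(Q)$ is the Boolean algebra of complemented elements of $Q$. $Max(Q)$ is the set of maximal elements of $Q\setminus\{1\}$, $r(Q)=\bigwedge Max(Q)$. A quantale $Q$ has property (*) if for every $x\in Q$ there exist $c\in K(Q)$ with $c\le r(Q)$ and $e\in B(Q)$ with $x=c\vee e$. For $a\in A$, $[a)_A=\{x\in A:a\le x\}$ is a quantale with the lattice operations of $A$, bottom $a$, top $1$, multiplication $x\cdot_a y=(x\cdot y)\vee a$. -}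

module Defs where

open import Level using (Level; suc; _⊔_; Lift; lift; lower)
open import Data.Bool using (Bool; true; false)
open import Data.Empty using (⊥-elim)
open import Data.Fin using (Fin)
open import Data.Nat using (ℕ)
open import Data.Product using (Σ; Σ-syntax; _×_; _,_; proj₁; proj₂)
open import Relation.Nullary using (¬_)

-- A complete lattice is presented by a preorder _≤_ together with
-- arbitrary joins ⋁ and meets ⋀ of families indexed by types in Set ℓ;
-- equality of elements is  x ≈ y = (x ≤ y × y ≤ x)  (so the order is a
-- partial order up to ≈).

record Quantale (ℓ : Level) : Set (suc ℓ) where
  infix 4 _≤_ _≈_
  infixl 7 _·_
  infixl 6 _∨_ _∧_
  field
    Carrier : Set ℓ
    _≤_     : Carrier → Carrier → Set ℓ
    ≤-refl  : ∀ {x} → x ≤ x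
    ≤-trans : ∀ {x y z} → x ≤ y → y ≤ z → x ≤ z

  _≈_ : Carrier → Carrier → Set ℓ
  x ≈ y = (x ≤ y) × (y ≤ x)

  field
    ⋁     : {I : Set ℓ} → (I → Carrier) → Carrier
    ⋁-ub  : ∀ {I : Set ℓ} (f : I → Carrier) (i : I) → f i ≤ ⋁ f
    ⋁-lub : ∀ {I : Set ℓ} (f : I → Carrier) (x : Carrier) →
            (∀ i → f i ≤ x) → ⋁ f ≤ x
    ⋀     : {I : Set ℓ} → (I → Carrier) → Carrier
    ⋀-lb  : ∀ {I : Set ℓ} (f : I → Carrier) (i : I) → ⋀ f ≤ f i
    ⋀-glb : ∀ {I : Set ℓ} (f : I → Carrier) (x : Carrier) →
            (∀ i → x ≤ f i) → x ≤ ⋀ f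
    ⊤     : Carrier
    ⊤-max : ∀ {x} → x ≤ ⊤
    _·_      : Carrier → Carrier → Carrier
    ·-assoc  : ∀ x y z → (x · y) · z ≈ x · (y · z)
    ·-comm   : ∀ x y → x · y ≈ y · x
    ·-mono   : ∀ {x x′ y y′} → x ≤ x′ → y ≤ y′ → x · y ≤ x′ · y′
    ·-unit   : ∀ x → x · ⊤ ≈ x
    ·-distrib : ∀ x {I : Set ℓ} (f : I → Carrier) →
                x · ⋁ f ≈ ⋁ (λ i → x · f i)

  ⊥ : Carrier
  ⊥ = ⋁ {Lift ℓ (Fin 0)} (λ ())

  pair : Carrier → Carrier → Lift ℓ Bool → Carrier
  pair x y (lift true)  = x
  pair x y (lift false) = y

  _∨_ : Carrier → Carrier → Carrier
  x ∨ y = ⋁ (pair x y)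

  _∧_ : Carrier → Carrier → Carrier
  x ∧ y = ⋀ (pair x y)

  ⋁fin : ∀ {n : ℕ} → (Fin n → Carrier) → Carrier
  ⋁fin {n} g = ⋁ {Lift ℓ (Fin n)} (λ k → g (lower k))

  Compact : Carrier → Set (suc ℓ)
  Compact c = ∀ {I : Set ℓ} (f : I → Carrier) → c ≤ ⋁ f →
              Σ[ n ∈ ℕ ] Σ[ g ∈ (Fin n → I) ] (c ≤ ⋁fin (λ k → f (g k)))

  Coherent : Set (suc ℓ)
  Coherent =
    (∀ x → Σ[ I ∈ Set ℓ ] Σ[ f ∈ (I → Carrier) ]
             ((∀ i → Compact (f i)) × (x ≈ ⋁ f)))
    × Compact ⊤
    × (∀ c d → Compact c → Compact d → Compact (c · d))

  Complemented : Carrier → Set ℓ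
  Complemented e = Σ[ f ∈ Carrier ] ((e ∨ f ≈ ⊤) × (e ∧ f ≈ ⊥))

  IsMax : Carrier → Set ℓ
  IsMax m = ¬ (m ≈ ⊤) × (∀ x → ¬ (x ≈ ⊤) → m ≤ x → x ≈ m)

  r : Carrier
  r = ⋀ {Σ Carrier IsMax} proj₁

  PropertyStar : Set (suc ℓ)
  PropertyStar = ∀ x → Σ[ c ∈ Carrier ] Σ[ e ∈ Carrier ]
    (Compact c × c ≤ r × Complemented e × (x ≈ c ∨ e))


module UpSetConstruction {ℓ : Level} (A : Quantale ℓ) (a : Quantale.Carrier A) where
  open Quantale A renaming (Carrier to C)

  U : Set ℓ
  U = Σ C (λ x → a ≤ x)

  ∨-ubˡ : ∀ {x y} → x ≤ x ∨ y
  ∨-ubˡ {x} {y} = ⋁-ub (pair x y) (lift true)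

  ∨-ubʳ : ∀ {x y} → y ≤ x ∨ y
  ∨-ubʳ {x} {y} = ⋁-ub (pair x y) (lift false)

  ∨-lub : ∀ {x y z} → x ≤ z → y ≤ z → x ∨ y ≤ z
  ∨-lub {x} {y} {z} p q = ⋁-lub (pair x y) z λ { (lift true) → p ; (lift false) → q }

  ∨-mono : ∀ {x x′ y y′} → x ≤ x′ → y ≤ y′ → x ∨ y ≤ x′ ∨ y′
  ∨-mono p q = ∨-lub (≤-trans p ∨-ubˡ) (≤-trans q ∨-ubʳ)

  ·-∨-distrib : ∀ x y z → x · (y ∨ z) ≤ x · y ∨ x · z
  ·-∨-distrib x y z =
    ≤-trans (proj₁ (·-distrib x (pair y z)))
      (⋁-lub _ _ λ { (lift true) → ∨-ubˡ ; (lift false) → ∨-ubʳ })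

  ·-∨-distribʳ : ∀ x y z → (x ∨ y) · z ≤ x · z ∨ y · z
  ·-∨-distribʳ x y z =
    ≤-trans (proj₁ (·-comm (x ∨ y) z))
      (≤-trans (·-∨-distrib z x y)
        (∨-mono (proj₁ (·-comm z x)) (proj₁ (·-comm z y))))

  ·-≤ˡ : ∀ x y → x · y ≤ x
  ·-≤ˡ x y = ≤-trans (·-mono ≤-refl ⊤-max) (proj₁ (·-unit x))

  ·-≤ʳ : ∀ x y → x · y ≤ y
  ·-≤ʳ x y = ≤-trans (proj₁ (·-comm x y)) (·-≤ˡ y x)

  absorbˡ : ∀ x z → (x ∨ a) · z ∨ a ≤ x · z ∨ a
  absorbˡ x z = ∨-lub (≤-trans (·-∨-distribʳ x a z) (∨-mono ≤-refl (·-≤ˡ a z))) ∨-ubʳ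

  absorbʳ : ∀ x z → x · (z ∨ a) ∨ a ≤ x · z ∨ a
  absorbʳ x z = ∨-lub (≤-trans (·-∨-distrib x z a) (∨-mono ≤-refl (·-≤ʳ x a))) ∨-ubʳ

  quantale : Quantale ℓ
  quantale = record
    { Carrier = U
    ; _≤_ = λ x y → proj₁ x ≤ proj₁ y
    ; ≤-refl = ≤-refl
    ; ≤-trans = ≤-trans
    ; ⋁ = λ f → (a ∨ ⋁ (λ i → proj₁ (f i))) , ∨-ubˡ
    ; ⋁-ub = λ f i → ≤-trans (⋁-ub (λ i → proj₁ (f i)) i) ∨-ubʳ
    ; ⋁-lub = λ f x h → ∨-lub (proj₂ x) (⋁-lub _ _ h)
    ; ⋀ = λ f → ⋀ (λ i → proj₁ (f i)) , ⋀-glb _ _ (λ i → proj₂ (f i))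
    ; ⋀-lb = λ f i → ⋀-lb _ i
    ; ⋀-glb = λ f x h → ⋀-glb _ _ h
    ; ⊤ = ⊤ , ⊤-max
    ; ⊤-max = ⊤-max
    ; _·_ = λ x y → (proj₁ x · proj₁ y ∨ a) , ∨-ubʳ
    ; ·-assoc = λ x y z →
        let x₁ = proj₁ x ; y₁ = proj₁ y ; z₁ = proj₁ z in
        ≤-trans (absorbˡ (x₁ · y₁) z₁)
          (≤-trans (∨-mono (proj₁ (·-assoc x₁ y₁ z₁)) ≤-refl)
            (∨-mono (·-mono ≤-refl ∨-ubˡ) ≤-refl))
        , ≤-trans (absorbʳ x₁ (y₁ · z₁))
          (≤-trans (∨-mono (proj₂ (·-assoc x₁ y₁ z₁)) ≤-refl)
            (∨-mono (·-mono ∨-ubˡ ≤-refl) ≤-refl))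
    ; ·-comm = λ x y → ∨-mono (proj₁ (·-comm _ _)) ≤-refl
                     , ∨-mono (proj₁ (·-comm _ _)) ≤-refl
    ; ·-mono = λ p q → ∨-mono (·-mono p q) ≤-refl
    ; ·-unit = λ x → ∨-lub (proj₁ (·-unit _)) (proj₂ x)
                   , ≤-trans (proj₂ (·-unit _)) ∨-ubˡ
    ; ·-distrib = λ x f →
        let x₁ = proj₁ x ; g = λ i → proj₁ (f i) in
        ∨-lub (≤-trans (·-∨-distrib x₁ a (⋁ g))
                (∨-mono (·-≤ʳ x₁ a)
                  (≤-trans (proj₁ (·-distrib x₁ g))
                     (⋁-lub _ _ λ i → ≤-trans ∨-ubˡ (⋁-ub (λ j → (x₁ · g j ∨ a)) i)))))
              ∨-ubˡ
        , ∨-lub ∨-ubʳ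
            (⋁-lub _ _ λ i → ∨-mono (·-mono ≤-refl (≤-trans (⋁-ub g i) ∨-ubʳ)) ≤-refl)
    }

UpSet : ∀ {ℓ} (A : Quantale ℓ) → Quantale.Carrier A → Quantale ℓ
UpSet A a = UpSetConstruction.quantale A a

open Quantale public using (Carrier; Coherent; PropertyStar; Compact; Complemented; IsMax; r)

-- The map  x ↦ x ∨ a  from A to [a)_A preserves binary joins
-- and sends compact elements to compact elements, elements below r(A) to
-- elements below r([a)_A) (a maximal element of [a)_A is maximal in A), and
-- complemented elements to complemented elements (if e ∨ f = 1 and e ∧ f = 0
-- then (e ∨ a) ∧ (f ∨ a) = (e ∨ a)(f ∨ a) ≤ ef ∨ a = a).  Applying it to a
-- decomposition x = c ∨ e in A of an element x ≥ a gives x = (c ∨ a) ∨ (e ∨ a)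
-- in [a)_A.
module Submission where

open import Defs
open import Level using (Level; lift; lower)
open import Data.Bool using (true; false)
open import Data.Nat using (ℕ; zero; suc)
open import Data.Fin using (Fin; zero; suc)
open import Data.Empty using (⊥-elim)
open import Data.Maybe using (Maybe; just; nothing; maybe)
open import Data.Maybe.Properties using (just-injective)
open import Data.Product using (Σ; Σ-syntax; ∃; _,_; proj₁; proj₂; map)
open import Data.Vec.Functional using (_∷_)
open import Function using (_∘_; id)
open import Relation.Binary.Bundles using (Preorder)
open import Relation.Binary.PropositionalEquality
  using (_≡_; _≢_; refl; sym; trans; isEquivalence)
import Relation.Binary.Reasoning.Preorder as PreorderReasoning

ImageOfJustsCoveredBy : ∀ {ℓ} {I : Set ℓ} {n m} → (Fin n → Maybe I) → (Fin m → I) → Set ℓ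
ImageOfJustsCoveredBy h g = ∀ k {i} → h k ≡ just i → ∃ λ k′ → g k′ ≡ i

dropNothings : ∀ {ℓ} {I : Set ℓ} {n} (h : Fin n → Maybe I) →
               Σ[ m ∈ ℕ ] Σ[ g ∈ (Fin m → I) ] ImageOfJustsCoveredBy h g
dropNothings {n = zero} h = zero , (λ ()) , λ ()
dropNothings {n = suc n} h with dropNothings (λ k → h (suc k)) | h zero in h0
... | m , g , covered | nothing = m , g , λ
  { zero h0≡just → ⊥-elim (nothing≢just (trans (sym h0) h0≡just))
  ; (suc k) → covered k }
  where
    nothing≢just : ∀ {i} → nothing ≢ just i
    nothing≢just ()
... | m , g , covered | just i = suc m , i ∷ g , λ
  { zero h0≡just → zero , just-injective (trans (sym h0) h0≡just)
  ; (suc k) hk≡just → map suc id (covered k hk≡just) }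

module QuantaleProperties {ℓ : Level} (Q : Quantale ℓ) where
  open Quantale Q renaming (Carrier to C)

  -- these lemmas of UpSetConstruction do not involve its base point
  open UpSetConstruction Q ⊥ public
    using (∨-ubˡ; ∨-ubʳ; ∨-lub; ∨-mono; ·-∨-distrib; ·-≤ˡ; ·-≤ʳ)

  ≤-preorder : Preorder ℓ ℓ ℓ
  ≤-preorder = record
    { _≈_ = _≡_
    ; _≲_ = _≤_
    ; isPreorder = record
      { isEquivalence = isEquivalence
      ; reflexive = λ { refl → ≤-refl }
      ; trans = ≤-trans
      }
    }

  ⊥-min : ∀ {x} → ⊥ ≤ x
  ⊥-min = ⋁-lub _ _ λ { (lift ()) }

  ∧-lbˡ : ∀ {x y} → x ∧ y ≤ x
  ∧-lbˡ {x} {y} = ⋀-lb (pair x y) (lift true)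

  ∧-lbʳ : ∀ {x y} → x ∧ y ≤ y
  ∧-lbʳ {x} {y} = ⋀-lb (pair x y) (lift false)

  ∧-glb : ∀ {x y z} → z ≤ x → z ≤ y → z ≤ x ∧ y
  ∧-glb {x} {y} z≤x z≤y = ⋀-glb (pair x y) _ λ { (lift true) → z≤x ; (lift false) → z≤y }

  ·-≤-∧ : ∀ x y → x · y ≤ x ∧ y
  ·-≤-∧ x y = ∧-glb (·-≤ˡ x y) (·-≤ʳ x y)

  ∧-≤-·-if-∨≈⊤ : ∀ {x y} → x ∨ y ≈ ⊤ → x ∧ y ≤ x · y
  ∧-≤-·-if-∨≈⊤ {x} {y} (_ , ⊤≤x∨y) = begin
    x ∧ y                         ≲⟨ proj₂ (·-unit (x ∧ y)) ⟩
    (x ∧ y) · ⊤                   ≲⟨ ·-mono ≤-refl ⊤≤x∨y ⟩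
    (x ∧ y) · (x ∨ y)             ≲⟨ ·-∨-distrib (x ∧ y) x y ⟩
    (x ∧ y) · x ∨ (x ∧ y) · y     ≲⟨ ∨-mono (·-mono ∧-lbʳ ≤-refl) (·-mono ∧-lbˡ ≤-refl) ⟩
    y · x ∨ x · y                 ≲⟨ ∨-lub (proj₁ (·-comm y x)) ≤-refl ⟩
    x · y                         ∎
    where open PreorderReasoning ≤-preorder

  ⋁fin-ub : ∀ {n} (f : Fin n → C) k → f k ≤ ⋁fin f
  ⋁fin-ub f k = ⋁-ub (λ k → f (lower k)) (lift k)

  ⋁fin-lub : ∀ {n} (f : Fin n → C) x → (∀ k → f k ≤ x) → ⋁fin f ≤ x
  ⋁fin-lub f x f≤x = ⋁-lub _ x λ k → f≤x (lower k)

  ∨-⋁-≤-⋁-maybe : ∀ {I : Set ℓ} (F : I → C) x → x ∨ ⋁ F ≤ ⋁ (maybe F x)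
  ∨-⋁-≤-⋁-maybe F x = ∨-lub (⋁-ub (maybe F x) nothing) (⋁-lub _ _ λ i → ⋁-ub (maybe F x) (just i))

  ⋁fin-maybe-≤ : ∀ {I : Set ℓ} {n m} (F : I → C) x (h : Fin n → Maybe I) (g : Fin m → I) →
                 ImageOfJustsCoveredBy h g → ⋁fin (λ k → maybe F x (h k)) ≤ x ∨ ⋁fin (λ k → F (g k))
  ⋁fin-maybe-≤ F x h g covered = ⋁fin-lub _ _ bound
    where
      bound : ∀ k → maybe F x (h k) ≤ x ∨ ⋁fin (λ k → F (g k))
      bound k with h k in hk
      ... | nothing = ∨-ubˡ
      ... | just i with covered k hk
      ...   | k′ , refl = ≤-trans (⋁fin-ub (λ k → F (g k)) k′) ∨-ubʳ

module UpSetProperties {ℓ : Level} (A : Quantale ℓ) (a : Quantale.Carrier A) where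
  open Quantale A renaming (Carrier to C)
    hiding (r; Compact; Complemented; IsMax; PropertyStar; Coherent)
  open QuantaleProperties A
  open UpSetConstruction A a using (U; absorbˡ; absorbʳ)
  module ↑A = Quantale (UpSet A a)
  module ↑P = QuantaleProperties (UpSet A a)

  ↑_ : C → U
  ↑ x = x ∨ a , ∨-ubʳ

  ↑-mono : ∀ {x y} → x ≤ y → ↑ x ↑A.≤ ↑ y
  ↑-mono x≤y = ∨-mono x≤y ≤-refl

  ↑-∨ : ∀ x y → ↑ (x ∨ y) ↑A.≈ ↑ x ↑A.∨ ↑ y
  ↑-∨ x y = ∨-lub (∨-lub (≤-trans ∨-ubˡ ↑P.∨-ubˡ) (≤-trans ∨-ubˡ ↑P.∨-ubʳ))
                  (proj₂ (↑ x ↑A.∨ ↑ y))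
          , ↑P.∨-lub {↑ x} {↑ y} {↑ (x ∨ y)} (↑-mono ∨-ubˡ) (↑-mono ∨-ubʳ)

  ↑-decomposition : ∀ (u : U) {x y} → proj₁ u ≈ x ∨ y → u ↑A.≈ ↑ x ↑A.∨ ↑ y
  ↑-decomposition (u , a≤u) {x} {y} (u≤x∨y , x∨y≤u) =
      ≤-trans u≤x∨y (≤-trans ∨-ubˡ (proj₁ (↑-∨ x y)))
    , ≤-trans (proj₂ (↑-∨ x y)) (∨-lub x∨y≤u a≤u)

  ↑-·-≤ : ∀ x y → (x ∨ a) · (y ∨ a) ≤ x · y ∨ a
  ↑-·-≤ x y = ≤-trans ∨-ubˡ (≤-trans (absorbˡ x (y ∨ a)) (absorbʳ x y))

  ↑-compact : ∀ {c} → Compact A c → ↑A.Compact (↑ c)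
  ↑-compact {c} c-compact {I} f ↑c≤⋁f
    with n , h , c≤⋁fin ← c-compact (maybe (proj₁ ∘ f) a)
                            (≤-trans ∨-ubˡ (≤-trans ↑c≤⋁f (∨-⋁-≤-⋁-maybe (proj₁ ∘ f) a)))
    with m , g , covered ← dropNothings h
    = m , g , ∨-lub (≤-trans c≤⋁fin (⋁fin-maybe-≤ (proj₁ ∘ f) a h g covered)) ∨-ubˡ

  IsMax-proj₁ : ∀ {m} → ↑A.IsMax m → IsMax A (proj₁ m)
  IsMax-proj₁ {m , a≤m} (m≉⊤ , m-max) =
    m≉⊤ , λ x x≉⊤ m≤x → m-max (x , ≤-trans a≤m m≤x) x≉⊤ m≤x

  ↑-≤-r : ∀ {c} → c ≤ r A → ↑ c ↑A.≤ ↑A.r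
  ↑-≤-r c≤r = ⋀-glb _ _ λ { (m , m-max) →
    ∨-lub (≤-trans c≤r (⋀-lb {Σ C (IsMax A)} proj₁ (proj₁ m , IsMax-proj₁ {m} m-max)))
          (proj₂ m) }

  ↑-complemented : ∀ {e} → Complemented A e → ↑A.Complemented (↑ e)
  ↑-complemented {e} (f , e∨f≈⊤ , e∧f≈⊥) = ↑ f , ↑e∨↑f≈⊤ , ↑e∧↑f≈⊥
    where
      ↑e∨↑f≈⊤ : ↑ e ↑A.∨ ↑ f ↑A.≈ ↑A.⊤
      ↑e∨↑f≈⊤ = ⊤-max , ≤-trans (proj₂ e∨f≈⊤) (≤-trans ∨-ubˡ (proj₁ (↑-∨ e f)))
      e∨a∨f∨a≈⊤ : (e ∨ a) ∨ (f ∨ a) ≈ ⊤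
      e∨a∨f∨a≈⊤ = ⊤-max , ≤-trans (proj₂ e∨f≈⊤) (∨-mono ∨-ubˡ ∨-ubˡ)
      ↑e∧↑f≤a : proj₁ (↑ e ↑A.∧ ↑ f) ≤ a
      ↑e∧↑f≤a = begin
        proj₁ (↑ e ↑A.∧ ↑ f)      ≲⟨ ∧-glb ↑P.∧-lbˡ ↑P.∧-lbʳ ⟩
        (e ∨ a) ∧ (f ∨ a)         ≲⟨ ∧-≤-·-if-∨≈⊤ e∨a∨f∨a≈⊤ ⟩
        (e ∨ a) · (f ∨ a)         ≲⟨ ↑-·-≤ e f ⟩
        e · f ∨ a                 ≲⟨ ∨-lub (≤-trans (·-≤-∧ e f) (≤-trans (proj₁ e∧f≈⊥) ⊥-min)) ≤-refl ⟩
        a                         ∎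
        where open PreorderReasoning ≤-preorder
      ↑e∧↑f≈⊥ : ↑ e ↑A.∧ ↑ f ↑A.≈ ↑A.⊥
      ↑e∧↑f≈⊥ = ≤-trans ↑e∧↑f≤a (proj₂ ↑A.⊥) , ↑P.⊥-min {↑ e ↑A.∧ ↑ f}

proposition6p12 : ∀ {ℓ} (A : Quantale ℓ) → Coherent A → (a : Carrier A) →
                  PropertyStar A → PropertyStar (UpSet A a)
proposition6p12 A _ a star (x , a≤x) with star x
... | c , e , c-compact , c≤r , e-complemented , x≈c∨e =
  ↑ c , ↑ e , ↑-compact c-compact , ↑-≤-r c≤r , ↑-complemented e-complemented ,
  ↑-decomposition (x , a≤x) x≈c∨e
  where open UpSetProperties A a
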